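{- For all integers $n\geq m\geq 1$, $$\beta(K_n\,\square\,K_m)=\begin{cases}\left\lfloor \tfrac23(n+m-1)\right\rfloor, & \text{if } m\leq n\leq 2m-1,\\ n-1, & \text{if } n\geq 2m-1.\end{cases}$$
   Context: $K_n$ is the complete graph on $n$ vertices. $d(v,w)$ denotes shortest-path distance. A vertex $x$ resolves $v,w$ if $d(v,x)\neq d(w,x)$; a set resolves a graph if every pair of distinct vertices is resolved by some vertex of the set; $\beta(G)$ is the minimum size of a resolving set. The cartesian product $G\,\square\,H$ has vertex set $V(G)\times V(H)$, with $(a,v)\sim(b,w)$ iff ($a=b$ and $vw\in E(H)$) or ($v=w$ and $ab\in E(G)$). -}

module Defs where

open import Data.Nat using (ℕ; zero; suc; _≤_)
open import Data.Fin using (Fin)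
open import Data.Product using (_×_; Σ; ∃; ∃-syntax; _,_)
open import Data.Sum using (_⊎_)
open import Data.List using (List; length)
open import Data.List.Relation.Unary.Any using (Any)
open import Relation.Binary.PropositionalEquality using (_≡_; _≢_)

record Graph : Set₁ where
  field
    V   : Set
    Adj : V → V → Set
open Graph public

K : ℕ → Graph
K n = record { V = Fin n ; Adj = λ a b → a ≢ b }

_□_ : Graph → Graph → Graph
G □ H = record
  { V   = V G × V H
  ; Adj = λ { (a , v) (b , w) → (a ≡ b × Adj H v w) ⊎ (v ≡ w × Adj G a b) } }

data Walk (G : Graph) : V G → V G → ℕ → Set where
  here : ∀ {v} → Walk G v v 0
  step : ∀ {u v w k} → Adj G u v → Walk G v w k → Walk G u w (suc k)

IsDist : (G : Graph) → V G → V G → ℕ → Set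
IsDist G v w k = Walk G v w k × (∀ j → Walk G v w j → k ≤ j)

ResolvesPair : (G : Graph) → V G → V G → V G → Set
ResolvesPair G x v w = ∀ i j → IsDist G v x i → IsDist G w x j → i ≢ j

Resolving : (G : Graph) → List (V G) → Set
Resolving G S = ∀ v w → v ≢ w → Any (λ x → ResolvesPair G x v w) S

IsMetricDim : Graph → ℕ → Set
IsMetricDim G k =
  (Σ (List (V G)) λ S → length S ≡ k × Resolving G S)
  × (∀ (S : List (V G)) → Resolving G S → k ≤ length S)

-- In the rook's graph K n □ K m the distance between two cells is the number of
-- coordinates in which they differ.  Hence a cell s separates two cells x, y lying
-- in different rows and columns exactly when s lies on one of the four lines
-- through x or y without being one of the two opposite corners of the rectangle
-- spanned by x and y; pairs in a common row or column are separated by the cells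
-- of their two columns (rows).
--
-- If a resolving set S left two rows empty, two cells of a column
-- lying in these rows would not be separated; likewise for columns.  If S had two
-- isolated cells (each alone in its row and its column), or one isolated cell
-- together with an empty row and an empty column, the other two corners of the
-- rectangle they span would not be separated.  Counting the cells of S row by row
-- and column by column gives 2 (occupied rows + occupied columns) ≤ 3 |S| +
-- (isolated cells), whence 2 (n + m - 1) ≤ 3 |S| + 2; the rows alone give
-- n - 1 ≤ |S|.
--
-- A set meeting every row but the last and every column but the
-- last, in which every cell shares a line with another cell of the set, is
-- resolving.  Two cells in a common row (column) meet three new lines, so such
-- sets are built from pairs, with ⌊2 (n + m - 1) / 3⌋ cells when m ≤ n ≤ 2m - 1,
-- and from column pairs plus single cells in the first column, with n - 1 cells,
-- when n ≥ 2m - 1.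

{-# OPTIONS --safe #-}
module Submission where

open import Defs
open import Data.Nat using (ℕ; _≤_; _+_; _*_; _∸_; _/_)
open import Data.Product using (_×_)

open import Data.Bool.Base using (true; false; if_then_else_)
open import Data.Empty using (⊥; ⊥-elim)
open import Data.Fin.Base as Fin using (Fin; toℕ)
open import Data.Fin.Patterns using (0F)
open import Data.Fin.Properties using (_≟_; toℕ-fromℕ<; toℕ-injective; toℕ≤pred[n]; suc-injective)
open import Data.List.Base using (List; []; _∷_; length; map)
open import Data.List.Membership.Propositional using (_∈_; find; lose)
open import Data.List.Membership.Propositional.Properties using (∈-map⁺)
open import Data.List.Properties using (length-map)
open import Data.List.Relation.Unary.All as All using (All; []; _∷_)
open import Data.List.Relation.Unary.All.Properties as All using (All¬⇒¬Any)
open import Data.List.Relation.Unary.Any as Any using (Any; here; there)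
import Data.List.Relation.Unary.Any.Properties as Any
open import Data.Nat.Base using (zero; suc; _<_; z≤n; s≤s)
open import Data.Nat.DivMod using (_mod_; m≤n⇒m%n≡m; m<n*o⇒m/o<n; +-distrib-/-∣ˡ)
open import Data.Nat.Divisibility using (divides-refl)
open import Data.Nat.Properties as ℕ hiding (_≟_; suc-injective)
open import Data.Nat.Tactic.RingSolver using (solve-∀)
open import Data.Product as Product using (Σ; ∃; _,_; proj₁; proj₂)
open import Data.Sum as Sum using (_⊎_; inj₁; inj₂)
open import Function.Base using (_∘_; _$_; id)
open import Relation.Binary.PropositionalEquality
open import Relation.Nullary using (¬_; does; yes; no; contradiction)
open import Relation.Nullary.Decidable using (dec-true; dec-false)

open import Algebra.Properties.CommutativeSemigroup +-commutativeSemigroup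
  using () renaming (interchange to +-interchange)
open import Algebra.Properties.Semiring.Sum +-*-semiring
  using (sum; sum-syntax; ∑-comm; ∑-distrib-+; *-distribˡ-sum; *-distribʳ-sum; sum-cong-≗; sum-replicate-zero)

-- Counting

sgn : ℕ → ℕ
sgn zero    = 0
sgn (suc _) = 1

isOne : ℕ → ℕ
isOne 1 = 1
isOne _ = 0

sgn≤ : ∀ x → sgn x ≤ x
sgn≤ zero    = z≤n
sgn≤ (suc _) = s≤s z≤n

isOne≤1 : ∀ x → isOne x ≤ 1
isOne≤1 0             = z≤n
isOne≤1 1             = ≤-refl
isOne≤1 (suc (suc _)) = z≤n

isOne⇒≡1 : ∀ {x} → 1 ≤ isOne x → x ≡ 1
isOne⇒≡1 {1} _ = refl

*-isOne : ∀ x → x * isOne x ≡ isOne x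
*-isOne 0             = refl
*-isOne 1             = refl
*-isOne (suc (suc x)) = *-zeroʳ (suc (suc x))

2*sgn≤ : ∀ x → 2 * sgn x ≤ x + isOne x
2*sgn≤ 0             = z≤n
2*sgn≤ 1             = ≤-refl
2*sgn≤ (suc (suc x)) = s≤s (s≤s z≤n)

*-split : ∀ x {p q} → p ≤ 1 → q ≤ 1 → x * p + x * q ≤ x + x * (p * q)
*-split x z≤n       q≤1 rewrite *-zeroʳ x | +-identityʳ x =
  ≤-trans (*-monoʳ-≤ x q≤1) (≤-reflexive (*-identityʳ x))
*-split x {q = q} (s≤s z≤n) _ rewrite *-identityʳ x | +-identityʳ q = ≤-refl

1≤*⇒ : ∀ x y → 1 ≤ x * y → 1 ≤ x × 1 ≤ y
1≤*⇒ (suc x) (suc y) _ = s≤s z≤n , s≤s z≤n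
1≤*⇒ (suc x) zero    h rewrite *-zeroʳ x = ⊥-elim (1+n≰n h)

sum-mono-≤ : ∀ {k} {f g : Fin k → ℕ} → (∀ i → f i ≤ g i) → sum f ≤ sum g
sum-mono-≤ {zero}  _   = z≤n
sum-mono-≤ {suc k} f≤g = +-mono-≤ (f≤g Fin.zero) (sum-mono-≤ (f≤g ∘ Fin.suc))

sum-zero : ∀ {k} {f : Fin k → ℕ} → (∀ i → f i ≡ 0) → sum f ≡ 0
sum-zero {k} f≡0 = trans (sum-cong-≗ f≡0) (sum-replicate-zero k)

term≤sum : ∀ {k} (f : Fin k → ℕ) i → f i ≤ sum f
term≤sum f Fin.zero    = m≤m+n _ _
term≤sum f (Fin.suc i) = ≤-trans (term≤sum (f ∘ Fin.suc) i) (m≤n+m _ _)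

terms≤sum : ∀ {k} (f : Fin k → ℕ) {i j} → i ≢ j → f i + f j ≤ sum f
terms≤sum f {Fin.zero}  {Fin.zero}  i≢j = ⊥-elim (i≢j refl)
terms≤sum f {Fin.zero}  {Fin.suc j} _   = +-monoʳ-≤ (f Fin.zero) (term≤sum (f ∘ Fin.suc) j)
terms≤sum f {Fin.suc i} {Fin.zero}  _   =
  ≤-trans (≤-reflexive (+-comm (f (Fin.suc i)) _)) (+-monoʳ-≤ (f Fin.zero) (term≤sum (f ∘ Fin.suc) i))
terms≤sum f {Fin.suc i} {Fin.suc j} i≢j =
  ≤-trans (terms≤sum (f ∘ Fin.suc) (i≢j ∘ cong Fin.suc)) (m≤n+m _ _)

positive-term : ∀ {k} (f : Fin k → ℕ) → 1 ≤ sum f → ∃ λ i → 1 ≤ f i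
positive-term {suc k} f h with f Fin.zero in f₀≡
... | suc _ = Fin.zero , subst (1 ≤_) (sym f₀≡) (s≤s z≤n)
... | zero  = Product.map Fin.suc id (positive-term (f ∘ Fin.suc) h)

positive-unique : ∀ {k} (f : Fin k → ℕ) → sum f ≤ 1 → ∀ {i j} → 1 ≤ f i → 1 ≤ f j → i ≡ j
positive-unique f sum≤1 {i} {j} fᵢ fⱼ with i ≟ j
... | yes i≡j = i≡j
... | no  i≢j = ⊥-elim (1+n≰n (≤-trans (+-mono-≤ fᵢ fⱼ) (≤-trans (terms≤sum f i≢j) sum≤1)))

sum≤1 : ∀ {k} (f : Fin k → ℕ) → (∀ i → f i ≤ 1) →
        (∀ {i j} → i ≢ j → 1 ≤ f i → 1 ≤ f j → ⊥) → sum f ≤ 1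
sum≤1 {zero}  _ _   _        = z≤n
sum≤1 {suc k} f ≤1 disjoint with n≤1⇒n≡0∨n≡1 (≤1 Fin.zero)
... | inj₁ f₀≡0 rewrite f₀≡0 =
  sum≤1 (f ∘ Fin.suc) (≤1 ∘ Fin.suc) (λ i≢j → disjoint (i≢j ∘ suc-injective))
... | inj₂ f₀≡1 rewrite f₀≡1 = ≤-reflexive (cong suc (sum-zero rest≡0))
  where
  rest≡0 : ∀ i → f (Fin.suc i) ≡ 0
  rest≡0 i with n≤1⇒n≡0∨n≡1 (≤1 (Fin.suc i))
  ... | inj₁ fᵢ≡0 = fᵢ≡0
  ... | inj₂ fᵢ≡1 = ⊥-elim (disjoint (λ ()) (≤-reflexive (sym f₀≡1)) (≤-reflexive (sym fᵢ≡1)))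

support : ∀ {k} → (Fin k → ℕ) → ℕ
support f = sum (sgn ∘ f)

support-full⊎zero : ∀ {k} (f : Fin k → ℕ) → support f ≡ k ⊎ ∃ λ i → f i ≡ 0
support-full⊎zero {zero}  f = inj₁ refl
support-full⊎zero {suc k} f with f Fin.zero in f₀≡
... | zero  = inj₂ (Fin.zero , f₀≡)
... | suc _ = Sum.map (cong suc) (Product.map Fin.suc id) (support-full⊎zero (f ∘ Fin.suc))

support-uniqueZero : ∀ {k} (f : Fin k → ℕ) → (∀ {i j} → i ≢ j → f i ≡ 0 → f j ≡ 0 → ⊥) →
                     k ≤ suc (support f)
support-uniqueZero {zero}  _ _ = z≤n
support-uniqueZero {suc k} f disjoint with f Fin.zero in f₀≡
... | suc _ = s≤s (support-uniqueZero (f ∘ Fin.suc) (λ i≢j → disjoint (i≢j ∘ suc-injective)))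
... | zero  with support-full⊎zero (f ∘ Fin.suc)
...   | inj₁ full       = s≤s (≤-reflexive (sym full))
...   | inj₂ (i , fᵢ≡0) = ⊥-elim (disjoint (λ ()) f₀≡ fᵢ≡0)

2*support≤ : ∀ {k} (f : Fin k → ℕ) → 2 * support f ≤ sum f + sum (isOne ∘ f)
2*support≤ f = begin
  2 * support f                    ≡⟨ *-distribˡ-sum 2 (sgn ∘ f) ⟩
  sum (λ i → 2 * sgn (f i))        ≤⟨ sum-mono-≤ (2*sgn≤ ∘ f) ⟩
  sum (λ i → f i + isOne (f i))    ≡⟨ ∑-distrib-+ f (isOne ∘ f) ⟩
  sum f + sum (isOne ∘ f)          ∎
  where open ≤-Reasoning

∑∑-distrib-+ : ∀ {n m} (f g : Fin n → Fin m → ℕ) →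
               ∑[ a < n ] ∑[ v < m ] (f a v + g a v)
                 ≡ ∑[ a < n ] ∑[ v < m ] f a v + ∑[ a < n ] ∑[ v < m ] g a v
∑∑-distrib-+ {n} {m} f g = trans (sum-cong-≗ λ a → ∑-distrib-+ (f a) (g a))
                                 (∑-distrib-+ (λ a → ∑[ v < m ] f a v) (λ a → ∑[ v < m ] g a v))

module Occupancy {n m : ℕ} (f : Fin n → Fin m → ℕ) where

  rowSum : Fin n → ℕ
  rowSum a = ∑[ v < m ] f a v

  colSum : Fin m → ℕ
  colSum v = ∑[ a < n ] f a v

  total : ℕ
  total = ∑[ a < n ] rowSum a

  isolated : Fin n → Fin m → ℕ
  isolated a v = f a v * (isOne (rowSum a) * isOne (colSum v))

  isolatedCount : ℕ
  isolatedCount = ∑[ a < n ] ∑[ v < m ] isolated a v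

  singletonLines≤ : sum (isOne ∘ rowSum) + sum (isOne ∘ colSum) ≤ total + isolatedCount
  singletonLines≤ = begin
    sum (isOne ∘ rowSum) + sum (isOne ∘ colSum)
      ≡⟨ cong₂ _+_ rows cols ⟨
    ∑[ a < n ] ∑[ v < m ] (f a v * isOne (rowSum a)) + ∑[ a < n ] ∑[ v < m ] (f a v * isOne (colSum v))
      ≡⟨ ∑∑-distrib-+ (λ a v → f a v * isOne (rowSum a)) (λ a v → f a v * isOne (colSum v)) ⟨
    ∑[ a < n ] ∑[ v < m ] (f a v * isOne (rowSum a) + f a v * isOne (colSum v))
      ≤⟨ sum-mono-≤ (λ a → sum-mono-≤ λ v → *-split (f a v) (isOne≤1 _) (isOne≤1 _)) ⟩
    ∑[ a < n ] ∑[ v < m ] (f a v + isolated a v)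
      ≡⟨ ∑∑-distrib-+ f isolated ⟩
    total + isolatedCount ∎
    where
    open ≤-Reasoning
    rows : ∑[ a < n ] ∑[ v < m ] (f a v * isOne (rowSum a)) ≡ sum (isOne ∘ rowSum)
    rows = sum-cong-≗ λ a → trans (sym (*-distribʳ-sum _ (f a))) (*-isOne (rowSum a))
    cols : ∑[ a < n ] ∑[ v < m ] (f a v * isOne (colSum v)) ≡ sum (isOne ∘ colSum)
    cols = trans (∑-comm (λ a v → f a v * isOne (colSum v)))
                 (sum-cong-≗ λ v → trans (sym (*-distribʳ-sum _ (λ a → f a v))) (*-isOne (colSum v)))

  occupied-bound : 2 * (support rowSum + support colSum) ≤ 3 * total + isolatedCount
  occupied-bound = begin
    2 * (support rowSum + support colSum)
      ≡⟨ *-distribˡ-+ 2 (support rowSum) (support colSum) ⟩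
    2 * support rowSum + 2 * support colSum
      ≤⟨ +-mono-≤ (2*support≤ rowSum) (2*support≤ colSum) ⟩
    (total + sum (isOne ∘ rowSum)) + (sum colSum + sum (isOne ∘ colSum))
      ≡⟨ cong (λ t → (total + sum (isOne ∘ rowSum)) + (t + sum (isOne ∘ colSum)))
              (∑-comm (λ v a → f a v)) ⟩
    (total + sum (isOne ∘ rowSum)) + (total + sum (isOne ∘ colSum))
      ≡⟨ +-interchange total _ total _ ⟩
    (total + total) + (sum (isOne ∘ rowSum) + sum (isOne ∘ colSum))
      ≤⟨ +-monoʳ-≤ (total + total) singletonLines≤ ⟩
    (total + total) + (total + isolatedCount)
      ≡⟨ regroup total isolatedCount ⟩
    3 * total + isolatedCount ∎
    where
    open ≤-Reasoning
    regroup : ∀ t i → (t + t) + (t + i) ≡ 3 * t + i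
    regroup = solve-∀

-- Distance in the rook's graph

Rook : ℕ → ℕ → Graph
Rook n m = K n □ K m

Cell : ℕ → ℕ → Set
Cell n m = Fin n × Fin m

differ : ∀ {k} → Fin k → Fin k → ℕ
differ a b = if does (a ≟ b) then 0 else 1

differ-refl : ∀ {k} (a : Fin k) → differ a a ≡ 0
differ-refl a rewrite dec-true (a ≟ a) refl = refl

differ-≢ : ∀ {k} {a b : Fin k} → a ≢ b → differ a b ≡ 1
differ-≢ {a = a} {b} a≢b rewrite dec-false (a ≟ b) a≢b = refl

differ≤1 : ∀ {k} (a b : Fin k) → differ a b ≤ 1
differ≤1 a b with does (a ≟ b)
... | true  = z≤n
... | false = ≤-refl

dist : ∀ {n m} → Cell n m → Cell n m → ℕ
dist (a , v) (b , w) = differ a b + differ v w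

module _ {n m : ℕ} where

  dist-refl : ∀ (x : Cell n m) → dist x x ≡ 0
  dist-refl (a , v) rewrite differ-refl a | differ-refl v = refl

  dist-adj : ∀ {x y z} → Adj (Rook n m) x y → dist x z ≤ suc (dist y z)
  dist-adj {a , v} {.a , w} {c , u} (inj₁ (refl , _)) =
    ≤-trans (+-monoʳ-≤ (differ a c) (≤-trans (differ≤1 v u) (s≤s z≤n))) (≤-reflexive (+-suc _ _))
  dist-adj {a , v} {b , .v} {c , u} (inj₂ (refl , _)) =
    +-monoˡ-≤ (differ v u) (≤-trans (differ≤1 a c) (s≤s z≤n))

  dist≤length : ∀ {x y k} → Walk (Rook n m) x y k → dist x y ≤ k
  dist≤length {x} here            = ≤-reflexive (dist-refl x)
  dist≤length     (step adj walk) = ≤-trans (dist-adj adj) (s≤s (dist≤length walk))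

  shortestWalk : ∀ (x y : Cell n m) → Walk (Rook n m) x y (dist x y)
  shortestWalk (a , v) (b , w) with a ≟ b | v ≟ w
  ... | yes refl | yes refl = here
  ... | yes refl | no v≢w   = step (inj₁ (refl , v≢w)) here
  ... | no a≢b   | yes refl = step (inj₂ (refl , a≢b)) here
  ... | no a≢b   | no v≢w   = step (inj₁ (refl , v≢w)) (step (inj₂ (refl , a≢b)) here)

  isDist-dist : ∀ (x y : Cell n m) → IsDist (Rook n m) x y (dist x y)
  isDist-dist x y = shortestWalk x y , λ _ → dist≤length

  isDist⇒≡dist : ∀ {x y k} → IsDist (Rook n m) x y k → k ≡ dist x y
  isDist⇒≡dist {x} {y} (walk , shortest) =
    ≤-antisym (shortest _ (shortestWalk x y)) (dist≤length walk)

  resolves⇒dist≢ : ∀ {s x y} → ResolvesPair (Rook n m) s x y → dist x s ≢ dist y s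
  resolves⇒dist≢ {s} {x} {y} r = r _ _ (isDist-dist x s) (isDist-dist y s)

  dist≢⇒resolves : ∀ {s x y} → dist x s ≢ dist y s → ResolvesPair (Rook n m) s x y
  dist≢⇒resolves ≢ _ _ dx dy i≡j =
    ≢ (trans (sym (isDist⇒≡dist dx)) (trans i≡j (isDist⇒≡dist dy)))

  unresolved : ∀ {S : List (Cell n m)} {x y} → x ≢ y → (∀ {s} → s ∈ S → dist x s ≡ dist y s) →
               ¬ Resolving (Rook n m) S
  unresolved x≢y same resolving =
    All¬⇒¬Any (All.tabulate λ s∈S → (_$ same s∈S) ∘ resolves⇒dist≢) (resolving _ _ x≢y)

SameLine : ∀ {A B : Set} → A × B → A × B → Set
SameLine (a , v) (b , w) = a ≡ b ⊎ v ≡ w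

Partner : ∀ {A B : Set} → List (A × B) → A × B → Set
Partner S s = Any (λ t → t ≢ s × SameLine t s) S

module _ {n m : ℕ} where

  dist≢-sameRow : ∀ {a c : Fin n} {v w : Fin m} → v ≢ w → dist (a , v) (c , v) ≢ dist (a , w) (c , v)
  dist≢-sameRow {a} {c} {v} v≢w rewrite differ-refl v | differ-≢ (≢-sym v≢w) =
    0≢1+n ∘ +-cancelˡ-≡ (differ a c) 0 1

  dist≢-sameCol : ∀ {a b : Fin n} {u v : Fin m} → a ≢ b → dist (a , v) (a , u) ≢ dist (b , v) (a , u)
  dist≢-sameCol {a} a≢b rewrite differ-refl a | differ-≢ (≢-sym a≢b) = 1+n≢n ∘ sym

  dist≡-sameRow : ∀ {a c : Fin n} {u v w : Fin m} → u ≢ v → u ≢ w →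
                  dist (a , v) (c , u) ≡ dist (a , w) (c , u)
  dist≡-sameRow u≢v u≢w rewrite differ-≢ (≢-sym u≢v) | differ-≢ (≢-sym u≢w) = refl

  dist≡-sameCol : ∀ {a b c : Fin n} {u v : Fin m} → c ≢ a → c ≢ b →
                  dist (a , v) (c , u) ≡ dist (b , v) (c , u)
  dist≡-sameCol c≢a c≢b rewrite differ-≢ (≢-sym c≢a) | differ-≢ (≢-sym c≢b) = refl

dist≢-onLine : ∀ {n m} {a b : Fin n} {v w : Fin m} {s} → a ≢ b → v ≢ w →
               SameLine s (a , v) → s ≢ (a , w) → s ≢ (b , v) → dist (a , v) s ≢ dist (b , w) s
dist≢-onLine {a = a} {b} {v} {w} {c , u} a≢b _ (inj₁ refl) s≢aw _
  rewrite differ-refl a | differ-≢ (≢-sym a≢b) | differ-≢ {a = w} {u} (s≢aw ∘ cong (a ,_) ∘ sym) =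
  <⇒≢ (s≤s (differ≤1 v u))
dist≢-onLine {a = a} {b} {v} {w} {c , u} _ v≢w (inj₂ refl) _ s≢bv
  rewrite differ-refl v | differ-≢ {a = b} {c} (s≢bv ∘ cong (_, v) ∘ sym) | differ-≢ (≢-sym v≢w)
        | +-identityʳ (differ a c) =
  <⇒≢ (s≤s (differ≤1 a c))

module _ {n m : ℕ} {a b : Fin n} {v w : Fin m} (a≢b : a ≢ b) (v≢w : v ≢ w) where

  onCornerLine : ∀ {t} → SameLine t (a , w) → (SameLine t (a , v) ⊎ SameLine t (b , w)) × t ≢ (b , v)
  onCornerLine (inj₁ refl) = inj₁ (inj₁ refl) , a≢b ∘ cong proj₁
  onCornerLine (inj₂ refl) = inj₂ (inj₂ refl) , ≢-sym v≢w ∘ cong proj₂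

  dist≢-diagonal : ∀ {s} → SameLine s (a , v) ⊎ SameLine s (b , w) →
                   s ≢ (a , w) → s ≢ (b , v) → dist (a , v) s ≢ dist (b , w) s
  dist≢-diagonal (inj₁ line) s≢aw s≢bv = dist≢-onLine a≢b v≢w line s≢aw s≢bv
  dist≢-diagonal (inj₂ line) s≢aw s≢bv =
    ≢-sym (dist≢-onLine (≢-sym a≢b) (≢-sym v≢w) line s≢bv s≢aw)

  dist≡-diagonal : ∀ {s} → (SameLine s (a , w) → s ≡ (a , w)) → (SameLine s (b , v) → s ≡ (b , v)) →
                   dist (a , v) s ≡ dist (b , w) s
  dist≡-diagonal {c , u} onAW onBV with c ≟ a | c ≟ b
  ... | yes refl | _ with onAW (inj₁ refl)
  ...   | refl rewrite differ-refl a | differ-refl w | differ-≢ v≢w | differ-≢ (≢-sym a≢b) = refl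
  dist≡-diagonal {c , u} onAW onBV | no c≢a | yes refl with onBV (inj₁ refl)
  ...   | refl rewrite differ-refl b | differ-refl v | differ-≢ a≢b | differ-≢ (≢-sym v≢w) = refl
  dist≡-diagonal {c , u} onAW onBV | no c≢a | no c≢b
    rewrite differ-≢ (≢-sym c≢a) | differ-≢ (≢-sym c≢b)
          | differ-≢ {a = v} {u} (c≢b ∘ cong proj₁ ∘ onBV ∘ inj₂ ∘ sym)
          | differ-≢ {a = w} {u} (c≢a ∘ cong proj₁ ∘ onAW ∘ inj₂ ∘ sym) = refl

distinct⇒1<n : ∀ {k} {i j : Fin k} → i ≢ j → 1 < k
distinct⇒1<n {suc zero}    {0F} {0F} i≢j = ⊥-elim (i≢j refl)
distinct⇒1<n {suc (suc k)}           _   = s≤s (s≤s z≤n)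

module _ {n m : ℕ} (S : List (Cell n m)) where

  resolving-criterion : (∀ {a b} → a ≢ b → Any (λ s → proj₁ s ≡ a ⊎ proj₁ s ≡ b) S) →
                        (∀ {v w} → v ≢ w → Any (λ s → proj₂ s ≡ v ⊎ proj₂ s ≡ w) S) →
                        (1 < m → All (Partner S) S) →
                        Resolving (Rook n m) S
  resolving-criterion rowsMet colsMet partnered (a , v) (b , w) x≢y with a ≟ b | v ≟ w
  ... | yes refl | yes refl = ⊥-elim (x≢y refl)
  ... | yes refl | no v≢w   = Any.map separate (colsMet v≢w)
    where
    separate : ∀ {s} → proj₂ s ≡ v ⊎ proj₂ s ≡ w → ResolvesPair (Rook n m) s (a , v) (a , w)
    separate {c , _} (inj₁ refl) = dist≢⇒resolves (dist≢-sameRow {a = a} {c} v≢w)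
    separate {c , _} (inj₂ refl) = dist≢⇒resolves (≢-sym (dist≢-sameRow {a = a} {c} (≢-sym v≢w)))
  ... | no a≢b   | yes refl = Any.map separate (rowsMet a≢b)
    where
    separate : ∀ {s} → proj₁ s ≡ a ⊎ proj₁ s ≡ b → ResolvesPair (Rook n m) s (a , v) (b , v)
    separate {_ , u} (inj₁ refl) = dist≢⇒resolves (dist≢-sameCol {u = u} {v} a≢b)
    separate {_ , u} (inj₂ refl) = dist≢⇒resolves (≢-sym (dist≢-sameCol {u = u} {v} (≢-sym a≢b)))
  ... | no a≢b   | no v≢w   = separate (find (rowsMet a≢b))
    where
    Separates : Cell n m → Set
    Separates s = ResolvesPair (Rook n m) s (a , v) (b , w)

    separates : ∀ {s} → SameLine s (a , v) ⊎ SameLine s (b , w) → s ≢ (a , w) → s ≢ (b , v) →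
                Separates s
    separates line s≢aw s≢bv = dist≢⇒resolves (dist≢-diagonal a≢b v≢w line s≢aw s≢bv)

    -- A cell of S at an opposite corner does not separate the pair, but its partner does.
    partnerOf-aw : Partner S (a , w) → Any Separates S
    partnerOf-aw = Any.map λ (t≢aw , line) →
      let line′ , t≢bv = onCornerLine a≢b v≢w line in separates line′ t≢aw t≢bv

    partnerOf-bv : Partner S (b , v) → Any Separates S
    partnerOf-bv = Any.map λ (t≢bv , line) →
      let line′ , t≢aw = onCornerLine (≢-sym a≢b) (≢-sym v≢w) line
      in  separates (Sum.swap line′) t≢aw t≢bv

    partners : All (Partner S) S
    partners = partnered (distinct⇒1<n v≢w)

    separate : ∃ (λ s → s ∈ S × (proj₁ s ≡ a ⊎ proj₁ s ≡ b)) → Any Separates S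
    separate ((c , u) , s∈S , inj₁ refl) with u ≟ w
    ... | yes refl = partnerOf-aw (All.lookup partners s∈S)
    ... | no u≢w   =
      lose s∈S (separates (inj₁ (inj₁ refl)) (u≢w ∘ cong proj₂) (a≢b ∘ cong proj₁))
    separate ((c , u) , s∈S , inj₂ refl) with u ≟ v
    ... | yes refl = partnerOf-bv (All.lookup partners s∈S)
    ... | no u≢v   =
      lose s∈S (separates (inj₂ (inj₁ refl)) (a≢b ∘ sym ∘ cong proj₁) (u≢v ∘ cong proj₂))

-- Lower bound

agree : ∀ {k} → Fin k → Fin k → ℕ
agree a b = if does (a ≟ b) then 1 else 0

agree-refl : ∀ {k} (a : Fin k) → agree a a ≡ 1
agree-refl a rewrite dec-true (a ≟ a) refl = refl

∑-agree : ∀ {k} (b : Fin k) → ∑[ a < k ] agree b a ≡ 1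
∑-agree {suc k} Fin.zero    = cong suc (sum-replicate-zero k)
∑-agree         (Fin.suc b) = ∑-agree b

Alone : ∀ {A B : Set} → List (A × B) → A × B → Set
Alone S x = ∀ {s} → s ∈ S → SameLine s x → s ≡ x

occurrences : ∀ {n m} → List (Cell n m) → Fin n → Fin m → ℕ
occurrences []             a v = 0
occurrences ((b , w) ∷ S) a v = agree b a * agree w v + occurrences S a v

module _ {n m : ℕ} where

  ∑∑occurrences≡length : ∀ (S : List (Cell n m)) → ∑[ a < n ] ∑[ v < m ] occurrences S a v ≡ length S
  ∑∑occurrences≡length []             = sum-zero {n} λ _ → sum-zero {m} λ _ → refl
  ∑∑occurrences≡length ((b , w) ∷ S) =
    trans (∑∑-distrib-+ (λ a v → agree b a * agree w v) (occurrences S))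
          (cong₂ _+_ single (∑∑occurrences≡length S))
    where
    single : ∑[ a < n ] ∑[ v < m ] (agree b a * agree w v) ≡ 1
    single = trans (sum-cong-≗ λ a → trans (sym (*-distribˡ-sum (agree b a) (agree w)))
                                           (trans (cong (agree b a *_) (∑-agree w)) (*-identityʳ _)))
                   (∑-agree b)

  ∈⇒occurs : ∀ {S : List (Cell n m)} {s} → s ∈ S → 1 ≤ occurrences S (proj₁ s) (proj₂ s)
  ∈⇒occurs {s = a , v} (here refl) rewrite agree-refl a | agree-refl v = s≤s z≤n
  ∈⇒occurs             (there s∈S) = ≤-trans (∈⇒occurs s∈S) (m≤n+m _ _)

module LowerBound {N M : ℕ} {S : List (Cell (suc N) (suc M))}
                  (resolving : Resolving (Rook (suc N) (suc M)) S) where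

  open Occupancy (occurrences S)

  private
    ∈⇒occupiedRow : ∀ {s} → s ∈ S → 1 ≤ rowSum (proj₁ s)
    ∈⇒occupiedRow {c , u} s∈S = ≤-trans (∈⇒occurs s∈S) (term≤sum (occurrences S c) u)

    ∈⇒occupiedCol : ∀ {s} → s ∈ S → 1 ≤ colSum (proj₂ s)
    ∈⇒occupiedCol {c , u} s∈S = ≤-trans (∈⇒occurs s∈S) (term≤sum (λ a → occurrences S a u) c)

    offEmptyRow : ∀ {a s} → rowSum a ≡ 0 → s ∈ S → proj₁ s ≢ a
    offEmptyRow rowEmpty s∈S refl = 1+n≰n (subst (1 ≤_) rowEmpty (∈⇒occupiedRow s∈S))

    offEmptyCol : ∀ {v s} → colSum v ≡ 0 → s ∈ S → proj₂ s ≢ v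
    offEmptyCol colEmpty s∈S refl = 1+n≰n (subst (1 ≤_) colEmpty (∈⇒occupiedCol s∈S))

  isolated⇒single : ∀ {a v} → 1 ≤ isolated a v → 1 ≤ occurrences S a v × rowSum a ≡ 1 × colSum v ≡ 1
  isolated⇒single {a} h =
    let occurs , singletons = 1≤*⇒ _ _ h
        row , col = 1≤*⇒ (isOne (rowSum a)) _ singletons
    in occurs , isOne⇒≡1 row , isOne⇒≡1 col

  isolated⇒alone : ∀ {a v} → 1 ≤ isolated a v → Alone S (a , v)
  isolated⇒alone {a} {v} h {c , u} s∈S line with isolated⇒single h
  ... | occurs , row , col with line
  ...   | inj₁ refl =
    cong (a ,_) (positive-unique (occurrences S a) (≤-reflexive row) (∈⇒occurs s∈S) occurs)
  ...   | inj₂ refl =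
    cong (_, v) (positive-unique (λ c → occurrences S c v) (≤-reflexive col) (∈⇒occurs s∈S) occurs)

  emptyLines⇒alone : ∀ {b w} → rowSum b ≡ 0 → colSum w ≡ 0 → Alone S (b , w)
  emptyLines⇒alone rowEmpty _ s∈S (inj₁ c≡b) = ⊥-elim (offEmptyRow rowEmpty s∈S c≡b)
  emptyLines⇒alone _ colEmpty s∈S (inj₂ u≡w) = ⊥-elim (offEmptyCol colEmpty s∈S u≡w)

  ¬alone-diagonal : ∀ {a b v w} → a ≢ b → v ≢ w → Alone S (a , v) → Alone S (b , w) → ⊥
  ¬alone-diagonal {a} {b} {v} {w} a≢b v≢w aloneAV aloneBW =
    unresolved {x = a , w} {y = b , v} (a≢b ∘ cong proj₁)
      (λ s∈S → dist≡-diagonal a≢b (≢-sym v≢w) (aloneAV s∈S) (aloneBW s∈S)) resolving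

  rows-occupied : N ≤ support rowSum
  rows-occupied = ≤-pred (support-uniqueZero rowSum λ {a} {b} a≢b rowEmptyA rowEmptyB →
    unresolved {x = a , 0F} {y = b , 0F} (a≢b ∘ cong proj₁)
      (λ { {_ , u} s∈S →
             dist≡-sameCol {u = u} {0F} (offEmptyRow rowEmptyA s∈S) (offEmptyRow rowEmptyB s∈S) })
      resolving)

  cols-occupied : M ≤ support colSum
  cols-occupied = ≤-pred (support-uniqueZero colSum λ {v} {w} v≢w colEmptyV colEmptyW →
    unresolved {x = 0F , v} {y = 0F , w} (v≢w ∘ cong proj₂)
      (λ { {c , _} s∈S →
             dist≡-sameRow {a = 0F} {c} (offEmptyCol colEmptyV s∈S) (offEmptyCol colEmptyW s∈S) })
      resolving)

  isolatedCount≤1 : isolatedCount ≤ 1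
  isolatedCount≤1 = sum≤1 isolatedInRow perRow disjoint
    where
    isolatedInRow : Fin (suc N) → ℕ
    isolatedInRow a = ∑[ v < suc M ] isolated a v

    perRow : ∀ a → isolatedInRow a ≤ 1
    perRow a = begin
      isolatedInRow a
        ≤⟨ sum-mono-≤ (λ v → *-monoʳ-≤ (occurrences S a v) (dropCol v)) ⟩
      ∑[ v < suc M ] (occurrences S a v * isOne (rowSum a))
        ≡⟨ *-distribʳ-sum _ (occurrences S a) ⟨
      rowSum a * isOne (rowSum a)
        ≡⟨ *-isOne (rowSum a) ⟩
      isOne (rowSum a)
        ≤⟨ isOne≤1 (rowSum a) ⟩
      1 ∎
      where
      open ≤-Reasoning
      dropCol : ∀ v → isOne (rowSum a) * isOne (colSum v) ≤ isOne (rowSum a)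
      dropCol v = ≤-trans (*-monoʳ-≤ (isOne (rowSum a)) (isOne≤1 (colSum v))) (≤-reflexive (*-identityʳ _))

    disjoint : ∀ {a b} → a ≢ b → 1 ≤ isolatedInRow a → 1 ≤ isolatedInRow b → ⊥
    disjoint {a} {b} a≢b inA inB
      with v , isoAV ← positive-term _ inA
      with w , isoBW ← positive-term _ inB =
      ¬alone-diagonal a≢b v≢w (isolated⇒alone isoAV) (isolated⇒alone isoBW)
      where
      v≢w : v ≢ w
      v≢w refl = let occursA , _ , col = isolated⇒single isoAV ; occursB , _ = isolated⇒single isoBW
                 in a≢b (positive-unique (λ c → occurrences S c v) (≤-reflexive col) occursA occursB)

  isolated⇒allLines : 1 ≤ isolatedCount → N + suc M ≤ support rowSum + support colSum
  isolated⇒allLines h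
    with a , inRow ← positive-term _ h
    with v , isoAV ← positive-term _ inRow
    with support-full⊎zero rowSum | support-full⊎zero colSum
  ... | inj₁ rowsFull | _ rewrite rowsFull =
    ≤-trans (≤-reflexive (+-suc N M)) (s≤s (+-monoʳ-≤ N cols-occupied))
  ... | inj₂ _ | inj₁ colsFull rewrite colsFull = +-monoˡ-≤ (suc M) rows-occupied
  ... | inj₂ (b , rowEmpty) | inj₂ (w , colEmpty) =
    ⊥-elim (¬alone-diagonal a≢b v≢w (isolated⇒alone isoAV) (emptyLines⇒alone rowEmpty colEmpty))
    where
    a≢b : a ≢ b
    a≢b refl = let _ , row , _ = isolated⇒single isoAV in 0≢1+n (trans (sym rowEmpty) row)
    v≢w : v ≢ w
    v≢w refl = let _ , _ , col = isolated⇒single isoAV in 0≢1+n (trans (sym colEmpty) col)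

  total≡length : total ≡ length S
  total≡length = ∑∑occurrences≡length S

  length-bound : 2 * (N + suc M) ≤ 3 * length S + 2
  length-bound with n≤1⇒n≡0∨n≡1 isolatedCount≤1
  ... | inj₁ none = begin
    2 * (N + suc M)                            ≡⟨ shift N M ⟩
    2 * (N + M) + 2                            ≤⟨ +-monoˡ-≤ 2 (*-monoʳ-≤ 2 lines≤occupied) ⟩
    2 * (support rowSum + support colSum) + 2  ≤⟨ +-monoˡ-≤ 2 occupied-bound ⟩
    3 * total + isolatedCount + 2              ≡⟨ cong₂ (λ t i → 3 * t + i + 2) total≡length none ⟩
    3 * length S + 0 + 2                       ≡⟨ cong (_+ 2) (+-identityʳ _) ⟩
    3 * length S + 2                           ∎
    where
    open ≤-Reasoning
    lines≤occupied : N + M ≤ support rowSum + support colSum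
    lines≤occupied = +-mono-≤ rows-occupied cols-occupied
    shift : ∀ N M → 2 * (N + suc M) ≡ 2 * (N + M) + 2
    shift = solve-∀
  ... | inj₂ one = begin
    2 * (N + suc M)                            ≤⟨ *-monoʳ-≤ 2 (isolated⇒allLines (≤-reflexive (sym one))) ⟩
    2 * (support rowSum + support colSum)      ≤⟨ occupied-bound ⟩
    3 * total + isolatedCount                  ≡⟨ cong₂ (λ t i → 3 * t + i) total≡length one ⟩
    3 * length S + 1                           ≤⟨ +-monoʳ-≤ (3 * length S) (n≤1+n 1) ⟩
    3 * length S + 2                           ∎
    where open ≤-Reasoning

  length-bound-rows : N ≤ length S
  length-bound-rows =
    ≤-trans rows-occupied (≤-trans (sum-mono-≤ (sgn≤ ∘ rowSum)) (≤-reflexive total≡length))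

-- Designs

Within : ℕ → ℕ → ℕ × ℕ → Set
Within N M (i , j) = i ≤ N × j ≤ M

-- Coordinates range over 0 … N and 0 … M, so a design lives in K (suc N) □ K (suc M).
-- With a single column no two cells differ in both coordinates, so partners are
-- only needed when M ≥ 1.
record Design (N M k : ℕ) : Set where
  field
    cells     : List (ℕ × ℕ)
    size      : length cells ≡ k
    bounded   : All (Within N M) cells
    rowsMet   : ∀ i → i < N → Any (λ s → proj₁ s ≡ i) cells
    colsMet   : ∀ j → j < M → Any (λ s → proj₂ s ≡ j) cells
    partnered : 1 ≤ M → All (Partner cells) cells

column : ∀ N → Design N 0 N
column zero = record
  { cells = [] ; size = refl ; bounded = [] ; rowsMet = λ _ () ; colsMet = λ _ () ; partnered = λ () }
column (suc N) = record
  { cells     = (N , 0) ∷ cells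
  ; size      = cong suc size
  ; bounded   = (n≤1+n N , z≤n) ∷ All.map (Product.map₁ m≤n⇒m≤1+n) bounded
  ; rowsMet   = λ i i<1+N → Sum.[ there ∘ rowsMet i , here ∘ sym ] (m<1+n⇒m<n∨m≡n i<1+N)
  ; colsMet   = λ _ ()
  ; partnered = λ ()
  }
  where open Design (column N)

colPair : ∀ {N M k} → Design N M k → Design (2 + N) (suc M) (2 + k)
colPair {N} {M} D = record
  { cells     = (N , M) ∷ (suc N , M) ∷ cells
  ; size      = cong (2 +_) size
  ; bounded   = (m≤n+m N 2 , n≤1+n M) ∷ (n≤1+n (suc N) , n≤1+n M)
              ∷ All.map (Product.map (λ i≤N → ≤-trans i≤N (m≤n+m N 2)) m≤n⇒m≤1+n) bounded
  ; rowsMet   = λ i i<2+N →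
      Sum.[ (λ i<1+N → Sum.[ there ∘ there ∘ rowsMet i , here ∘ sym ] (m<1+n⇒m<n∨m≡n i<1+N))
          , there ∘ here ∘ sym ] (m<1+n⇒m<n∨m≡n i<2+N)
  ; colsMet   = λ j j<1+M → Sum.[ there ∘ there ∘ colsMet j , here ∘ sym ] (m<1+n⇒m<n∨m≡n j<1+M)
  ; partnered = λ _ → there (here (1+n≢n ∘ cong proj₁ , inj₂ refl))
                    ∷ here (1+n≢n ∘ sym ∘ cong proj₁ , inj₂ refl)
                    ∷ oldPartners M bounded partnered
  }
  where
  open Design D
  oldPartners : ∀ M {L} → All (Within N M) L → (1 ≤ M → All (Partner L) L) →
                All (Partner ((N , M) ∷ (suc N , M) ∷ L)) L
  oldPartners (suc M) _      partnered = All.map (there ∘ there) (partnered (s≤s z≤n))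
  oldPartners zero    within _         =
    All.map (λ (i≤N , j≤0) →
               there (here (<⇒≢ (s≤s i≤N) ∘ sym ∘ cong proj₁ , inj₂ (sym (n≤0⇒n≡0 j≤0)))))
            within

rowPair : ∀ {N M k} → Design N M k → Design (suc N) (2 + M) (2 + k)
rowPair {N} {M} D = record
  { cells     = (N , M) ∷ (N , suc M) ∷ cells
  ; size      = cong (2 +_) size
  ; bounded   = (n≤1+n N , m≤n+m M 2) ∷ (n≤1+n N , n≤1+n (suc M))
              ∷ All.map (Product.map m≤n⇒m≤1+n (λ j≤M → ≤-trans j≤M (m≤n+m M 2))) bounded
  ; rowsMet   = λ i i<1+N → Sum.[ there ∘ there ∘ rowsMet i , here ∘ sym ] (m<1+n⇒m<n∨m≡n i<1+N)
  ; colsMet   = λ j j<2+M →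
      Sum.[ (λ j<1+M → Sum.[ there ∘ there ∘ colsMet j , here ∘ sym ] (m<1+n⇒m<n∨m≡n j<1+M))
          , there ∘ here ∘ sym ] (m<1+n⇒m<n∨m≡n j<2+M)
  ; partnered = λ _ → there (here (1+n≢n ∘ cong proj₂ , inj₁ refl))
                    ∷ here (1+n≢n ∘ sym ∘ cong proj₂ , inj₁ refl)
                    ∷ oldPartners M bounded partnered
  }
  where
  open Design D
  oldPartners : ∀ M {L} → All (Within N M) L → (1 ≤ M → All (Partner L) L) →
                All (Partner ((N , M) ∷ (N , suc M) ∷ L)) L
  oldPartners (suc M) _      partnered = All.map (there ∘ there) (partnered (s≤s z≤n))
  oldPartners zero    within _         = All.map partner within
    where
    partner : ∀ {s L} → Within N 0 s → Partner ((N , 0) ∷ (N , 1) ∷ L) s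
    partner {i , j} (_ , j≤0) with i ℕ.≟ N
    ... | yes refl = there (here (<⇒≢ (s≤s j≤0) ∘ sym ∘ cong proj₂ , inj₁ refl))
    ... | no  i≢N  = here (i≢N ∘ sym ∘ cong proj₁ , inj₂ (sym (n≤0⇒n≡0 j≤0)))

-- ⌊2 (n + m - 1) / 3⌋ for n = suc N and m = suc M.
optimal : ℕ → ℕ → ℕ
optimal N M = 2 * (N + suc M) / 3

optimal-+3 : ∀ {N M N′ M′} → N′ + suc M′ ≡ 3 + (N + suc M) → optimal N′ M′ ≡ 2 + optimal N M
optimal-+3 {N} {M} {N′} {M′} moreLines = begin
  2 * (N′ + suc M′) / 3        ≡⟨ cong (λ l → 2 * l / 3) moreLines ⟩
  2 * (3 + (N + suc M)) / 3    ≡⟨ cong (_/ 3) (*-distribˡ-+ 2 3 (N + suc M)) ⟩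
  (6 + 2 * (N + suc M)) / 3    ≡⟨ +-distrib-/-∣ˡ (2 * (N + suc M)) {d = 3} (divides-refl 2) ⟩
  2 + optimal N M              ∎
  where open ≡-Reasoning

colPair-optimal : ∀ {N M} → Design N M (optimal N M) → Design (2 + N) (suc M) (optimal (2 + N) (suc M))
colPair-optimal {N} {M} D = subst (Design _ _) (sym (optimal-+3 {N′ = 2 + N} {suc M} (lines N M))) (colPair D)
  where
  lines : ∀ N M → (2 + N) + suc (suc M) ≡ 3 + (N + suc M)
  lines = solve-∀

rowPair-optimal : ∀ {N M} → Design N M (optimal N M) → Design (suc N) (2 + M) (optimal (suc N) (2 + M))
rowPair-optimal {N} {M} D = subst (Design _ _) (sym (optimal-+3 {N′ = suc N} {2 + M} (lines N M))) (rowPair D)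
  where
  lines : ∀ N M → suc N + suc (2 + M) ≡ 3 + (N + suc M)
  lines = solve-∀

diagonal : ∀ k → Design k k (optimal k k)
diagonal 0 = column 0
diagonal 1 = record
  { cells     = (0 , 0) ∷ (0 , 1) ∷ []
  ; size      = refl
  ; bounded   = (z≤n , z≤n) ∷ (z≤n , s≤s z≤n) ∷ []
  ; rowsMet   = λ { 0 _ → here refl ; (suc _) (s≤s ()) }
  ; colsMet   = λ { 0 _ → here refl ; (suc _) (s≤s ()) }
  ; partnered = λ _ → there (here ((λ ()) , inj₁ refl)) ∷ here ((λ ()) , inj₁ refl) ∷ []
  }
diagonal 2                   = rowPair-optimal (column 1)
diagonal (suc (suc (suc k))) = colPair-optimal (rowPair-optimal (diagonal k))

double-suc : ∀ M → suc M + suc M ≡ 2 + (M + M)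
double-suc M = cong suc (+-suc M M)

balanced : ∀ N M → M ≤ N → N ≤ M + M → Design N M (optimal N M)
balanced zero          zero          _           _ = diagonal 0
balanced (suc zero)    (suc zero)    _           _ = diagonal 1
balanced (suc (suc N)) (suc M)       (s≤s M≤1+N) N≤2M with m≤n⇒m<n∨m≡n M≤1+N
... | inj₁ (s≤s M≤N) =
  colPair-optimal (balanced N M M≤N (≤-pred (≤-pred (subst (suc (suc N) ≤_) (double-suc M) N≤2M))))
... | inj₂ refl      = diagonal (suc (suc N))
balanced zero          (suc _)       ()          _
balanced (suc zero)    zero          _           ()
balanced (suc zero)    (suc (suc _)) (s≤s ())    _
balanced (suc (suc _)) zero          _           ()

unbalanced : ∀ N M → M + M ≤ N → Design N M N
unbalanced N             zero    _       = column N
unbalanced (suc (suc N)) (suc M) 2M≤N    =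
  colPair (unbalanced N M (≤-pred (≤-pred (subst (_≤ suc (suc N)) (double-suc M) 2M≤N))))
unbalanced zero          (suc M) ()
unbalanced (suc zero)    (suc M) (s≤s h) = contradiction (m+n≤o⇒n≤o M h) λ ()

toℕ-mod : ∀ {i} N → i ≤ N → toℕ (i mod suc N) ≡ i
toℕ-mod N i≤N = trans (toℕ-fromℕ< _) (m≤n⇒m%n≡m i≤N)

mod-toℕ : ∀ {N} (a : Fin (suc N)) → toℕ a mod suc N ≡ a
mod-toℕ {N} a = toℕ-injective (toℕ-mod N (toℕ≤pred[n] a))

below-last : ∀ {N} {a b : Fin (suc N)} → a ≢ b → toℕ a < N ⊎ toℕ b < N
below-last {N} {a} {b} a≢b with toℕ a ℕ.≟ N
... | no  a≢N = inj₁ (≤∧≢⇒< (toℕ≤pred[n] a) a≢N)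
... | yes a≡N =
  inj₂ (≤∧≢⇒< (toℕ≤pred[n] b) λ b≡N → a≢b (toℕ-injective (trans a≡N (sym b≡N))))

module _ {N M : ℕ} where

  toCell : ℕ × ℕ → Cell (suc N) (suc M)
  toCell (i , j) = i mod suc N , j mod suc M

  toCell-injective : ∀ {s t} → Within N M s → Within N M t → toCell s ≡ toCell t → s ≡ t
  toCell-injective (i≤N , j≤M) (i′≤N , j′≤M) eq = cong₂ _,_
    (trans (sym (toℕ-mod N i≤N)) (trans (cong (toℕ ∘ proj₁) eq) (toℕ-mod N i′≤N)))
    (trans (sym (toℕ-mod M j≤M)) (trans (cong (toℕ ∘ proj₂) eq) (toℕ-mod M j′≤M)))

  design⇒resolving : ∀ {k} → Design N M k →
                     Σ (List (Cell (suc N) (suc M))) λ S → length S ≡ k × Resolving (Rook (suc N) (suc M)) S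
  design⇒resolving D = S , trans (length-map toCell cells) size , resolving-criterion S
    (λ a≢b → Sum.[ Any.map inj₁ ∘ rowMet _ , Any.map inj₂ ∘ rowMet _ ] (below-last a≢b))
    (λ v≢w → Sum.[ Any.map inj₁ ∘ colMet _ , Any.map inj₂ ∘ colMet _ ] (below-last v≢w))
    (λ 1<m → All.map⁺ (All.map (λ (within , p) → partner within p)
                               (All.zip (bounded , partnered (≤-pred 1<m)))))
    where
    open Design D

    S : List (Cell (suc N) (suc M))
    S = map toCell cells

    rowMet : ∀ a → toℕ a < N → Any (λ s → proj₁ s ≡ a) S
    rowMet a a<N =
      Any.map⁺ (Any.map (λ i≡a → trans (cong (_mod suc N) i≡a) (mod-toℕ a)) (rowsMet (toℕ a) a<N))

    colMet : ∀ v → toℕ v < M → Any (λ s → proj₂ s ≡ v) S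
    colMet v v<M =
      Any.map⁺ (Any.map (λ j≡v → trans (cong (_mod suc M) j≡v) (mod-toℕ v)) (colsMet (toℕ v) v<M))

    partner : ∀ {s} → Within N M s → Partner cells s → Partner S (toCell s)
    partner within p with t , t∈ , t≢s , line ← find p =
      lose (∈-map⁺ toCell t∈)
           ( t≢s ∘ toCell-injective (All.lookup bounded t∈) within
           , Sum.map (cong (_mod suc N)) (cong (_mod suc M)) line)

/3≤ : ∀ {x k} → x ≤ 3 * k + 2 → x / 3 ≤ k
/3≤ {x} {k} x≤ = ≤-pred (m<n*o⇒m/o<n (≤-trans (s≤s x≤) (≤-reflexive (round k))))
  where
  round : ∀ k → suc (3 * k + 2) ≡ suc k * 3
  round = solve-∀

2*suc∸1 : ∀ M → 2 * suc M ∸ 1 ≡ suc (M + M)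
2*suc∸1 M = trans (+-suc M (M + 0)) (cong (suc ∘ (M +_)) (+-identityʳ M))

theorem6p1 : ∀ (n m : ℕ) → 1 ≤ m → m ≤ n →
    (n ≤ 2 * m ∸ 1 → IsMetricDim (K n □ K m) ((2 * (n + m ∸ 1)) / 3))
    × (2 * m ∸ 1 ≤ n → IsMetricDim (K n □ K m) (n ∸ 1))
theorem6p1 _       zero    ()  _
theorem6p1 zero    (suc _) _   ()
theorem6p1 (suc N) (suc M) _   (s≤s M≤N) = balancedCase , unbalancedCase
  where
  balancedCase : suc N ≤ 2 * suc M ∸ 1 → IsMetricDim (Rook (suc N) (suc M)) (optimal N M)
  balancedCase n≤2m-1 =
    design⇒resolving (balanced N M M≤N (≤-pred (subst (suc N ≤_) (2*suc∸1 M) n≤2m-1))) ,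
    λ _ resolving → /3≤ (LowerBound.length-bound resolving)

  unbalancedCase : 2 * suc M ∸ 1 ≤ suc N → IsMetricDim (Rook (suc N) (suc M)) N
  unbalancedCase 2m-1≤n =
    design⇒resolving (unbalanced N M (≤-pred (subst (_≤ suc N) (2*suc∸1 M) 2m-1≤n))) ,
    λ _ resolving → LowerBound.length-bound-rows resolving
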